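{- Let $N$ be a network and $X\subseteq\Phi(N)$ any set of formulas, and let ${\cal P}_0$ be the protocol over $N$ constructed from $N$ and $X$ as described in the context. For any sets of channels $A,B\subseteq Ch(N)$, if $A$ functionally determines $B$ with respect to ${\cal P}_0$, then $X\vdash_N A\rhd B$.
   Context: A network $N$ is a finite undirected graph (loops and multiple edges allowed) whose vertices are parties and whose edges, called channels, are labeled by secret variables; $Ch(N)$ is the set of channels and $Inc(p)$ the set of channels incident with party $p$. A semi-protocol over $N$ assigns to each channel $c$ a set $V(c)$ of values and to each party $p$ a predicate $L_p$ on the values of the channels in $Inc(p)$; a run is a function $r$ with $r(c)\in V(c)$ for all $c$ satisfying all $L_p$; a protocol is a semi-protocol with at least one run. $A$ functionally determines $B$ w.r.t. a protocol if any two runs agreeing on all channels of $A$ agree on all channels of $B$. A path is a sequence of channels forming an undirected walk; $G$ is a gateway between $A$ and $B$ if every path starting in $A$ and ending in $B$ contains a channel of $G$. $\Phi(N)$ is the smallest set of formulas containing $A\rhd B$ for finite sets of channels $A,B$, the constant $\bot$, and closed under $\to$. The Logic of Secrets for $N$: propositional tautologies, Modus Ponens, and axioms Reflexivity ($A\rhd B$ if $A\supseteq B$), Augmentation ($A\rhd B\to A\cup C\rhd B\cup C$), Transitivity ($A\rhd B\to(B\rhd C\to A\rhd C)$), Gateway ($A\rhd B\to G\rhd B$ if $G$ is a gateway between $A$ and $B$ in $N$); $X\vdash_N\psi$ means derivability from $X$. For $E\subseteq Ch(N)$ let $E^*=\{c\in Ch(N): X\vdash_N E\rhd\{c\}\}$.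 Protocol ${\cal P}_0$: for each channel $c$, $V(c)$ is the set of functions $f:2^{Ch(N)}\to\{0,1\}$ such that $f(E)=0$ whenever $c\in E^*$; writing $r(c,E)$ for $r(c)(E)$, the local condition at party $p$ is: for all $E\subseteq Ch(N)$ and all $c,d\in Inc(p)\setminus E^*$, $r(c,E)=r(d,E)$. (The constant-zero assignment is a run, so ${\cal P}_0$ is a protocol.) -}

module Defs where

open import Data.Nat using (ℕ)
open import Data.Fin using (Fin)
open import Data.Fin.Subset using (Subset; _∈_; _⊆_; _∪_; ⁅_⁆)
open import Data.Bool using (Bool; true; false; not; _∨_)
open import Data.Product using (_×_; _,_; Σ)
open import Data.Sum using (_⊎_)
open import Data.List using (List; []; _∷_)
open import Data.List.NonEmpty using (List⁺; head; last; toList)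
open import Data.List.Relation.Unary.Any using (Any)
open import Relation.Binary.PropositionalEquality using (_≡_)
open import Relation.Nullary using (¬_)

-- Networks: finite undirected multigraphs (loops and multiple edges
-- allowed).  Parties are Fin parties, channels are Fin channels, and
-- each channel has an (unordered) pair of end-parties, given as a pair.

record Network : Set where
  field
    parties  : ℕ
    channels : ℕ
    ends     : Fin channels → Fin parties × Fin parties

open Network public

Party : Network → Set
Party N = Fin (parties N)

Channel : Network → Set
Channel N = Fin (channels N)

ChSet : Network → Set
ChSet N = Subset (channels N)

Joins : (N : Network) → Channel N → Party N → Party N → Set
Joins N c p q = (ends N c ≡ (p , q)) ⊎ (ends N c ≡ (q , p))

Incident : (N : Network) → Party N → Channel N → Set
Incident N p c = Σ (Party N) (λ q → Joins N c p q)

data Walk (N : Network) : Party N → List (Channel N) → Party N → Set where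
  nil  : ∀ {p} → Walk N p [] p
  cons : ∀ {p q r c cs} → Joins N c p q → Walk N q cs r → Walk N p (c ∷ cs) r

IsPath : (N : Network) → List⁺ (Channel N) → Set
IsPath N π = Σ (Party N) (λ p → Σ (Party N) (λ q → Walk N p (toList π) q))

Gateway : (N : Network) → ChSet N → ChSet N → ChSet N → Set
Gateway N G A B =
  (π : List⁺ (Channel N)) → IsPath N π → head π ∈ A → last π ∈ B →
  Any (_∈ G) (toList π)

infixr 4 _⇒_
infix 6 _▷_

data Formula (N : Network) : Set where
  _▷_ : ChSet N → ChSet N → Formula N
  ⊥f  : Formula N
  _⇒_ : Formula N → Formula N → Formula N

eval : {N : Network} → (ChSet N → ChSet N → Bool) → Formula N → Bool
eval v (A ▷ B) = v A B
eval v ⊥f      = false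
eval v (φ ⇒ ψ) = not (eval v φ) ∨ eval v ψ

Tautology : {N : Network} → Formula N → Set
Tautology {N} φ = (v : ChSet N → ChSet N → Bool) → eval v φ ≡ true

data Derivable (N : Network) (X : Formula N → Set) : Formula N → Set where
  hyp          : ∀ {φ} → X φ → Derivable N X φ
  taut         : ∀ {φ} → Tautology φ → Derivable N X φ
  mp           : ∀ {φ ψ} → Derivable N X (φ ⇒ ψ) → Derivable N X φ → Derivable N X ψ
  reflexivity  : ∀ {A B} → B ⊆ A → Derivable N X (A ▷ B)
  augmentation : ∀ {A B C} → Derivable N X (A ▷ B ⇒ (A ∪ C) ▷ (B ∪ C))
  transitivity : ∀ {A B C} → Derivable N X (A ▷ B ⇒ (B ▷ C ⇒ A ▷ C))
  gateway      : ∀ {A B G} → Gateway N G A B → Derivable N X (A ▷ B ⇒ G ▷ B)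


_∈*_ : {N : Network} {X : Formula N → Set} → Channel N → ChSet N → Set
_∈*_ {N} {X} c E = Derivable N X (E ▷ ⁅ c ⁆)

module P₀ (N : Network) (X : Formula N → Set) where

  Star : ChSet N → Channel N → Set
  Star E c = _∈*_ {N} {X} c E

  V : Channel N → (ChSet N → Bool) → Set
  V c f = (E : ChSet N) → Star E c → f E ≡ false

  L : (p : Party N) → ((c : Channel N) → Incident N p c → ChSet N → Bool) → Set
  L p r = (E : ChSet N) (c d : Channel N) (ic : Incident N p c) (id : Incident N p d) →
          ¬ Star E c → ¬ Star E d → r c ic E ≡ r d id E

  record Run : Set where
    field
      val    : Channel N → ChSet N → Bool
      inV    : (c : Channel N) → V c (val c)
      local  : (p : Party N) → L p (λ c _ → val c)

  open Run public

  -- two runs agree on channel c (equality of function values, i.e.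
  -- extensional equality of the functions r(c), r'(c))
  AgreeOn : Run → Run → Channel N → Set
  AgreeOn r r′ c = (E : ChSet N) → val r c E ≡ val r′ c E

  FunctionallyDetermines : ChSet N → ChSet N → Set
  FunctionallyDetermines A B =
    (r r′ : Run) → ((c : Channel N) → c ∈ A → AgreeOn r r′ c) →
    (c : Channel N) → c ∈ B → AgreeOn r r′ c

module Submission where

-- Two facts combine.
--   * Syntactic: the logic admits a union rule (A ▷ S and A ▷ T give
--     A ▷ S ∪ T), hence a pointwise rule: if A ▷ {c} for every c ∈ B,
--     then A ▷ B.  This is proved by folding the union rule over the
--     finitely many channels, using the pieces B ∩ {c}.
--   * Semantic: for every c ∈ B we get A ▷ {c}, i.e. c ∈ A*.  Compare the
--     all-zero run with the "separating" run that sets r(c,E) = 1 exactly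
--     when E = A and c ∉ A*.  The latter is a run of P₀, and it agrees
--     with the zero run on A because A ⊆ A* by Reflexivity.  Functional
--     determination then forces r(c,A) = 0 for c ∈ B, which means c ∈ A*.
-- The separating run needs to decide membership in A*; this is the only
-- place where the excluded middle hypothesis is used.

open import Defs
open import Level using (0ℓ)
open import Axiom.ExcludedMiddle using (ExcludedMiddle)
open import Data.Nat using (ℕ)
open import Data.Bool using (Bool; true; false)
import Data.Bool as Bool
open import Data.Fin using (Fin)
open import Data.Fin.Subset using (Subset; _∈_; _⊆_; _∪_; _∩_; ⁅_⁆; ⋃)
open import Data.Fin.Subset.Properties
  using (_∈?_; ⊆-reflexive; ∪-idem; ∪-comm; p⊆p∪q; q⊆p∪q; x∈p∩q⁺; x∈p∩q⁻; p∩q⊆q;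
         x∈⁅x⁆; x∈⁅y⁆⇒x≡y; ⊥⊆)
open import Data.Vec.Properties using (≡-dec)
open import Data.List using (List; []; _∷_; map; allFin)
open import Data.List.Relation.Unary.Any using (here; there)
import Data.List.Membership.Propositional as List
open import Data.List.Membership.Propositional.Properties using (∈-allFin)
open import Data.Product using (_,_)
open import Data.Empty using (⊥-elim)
open import Relation.Nullary using (Dec; yes; no; ¬_)
open import Relation.Binary.PropositionalEquality using (_≡_; refl; sym; subst)

_≟ˢ_ : {n : ℕ} (S T : Subset n) → Dec (S ≡ T)
_≟ˢ_ = ≡-dec Bool._≟_

⁅⁆⊆ : {n : ℕ} {c : Fin n} {A : Subset n} → c ∈ A → ⁅ c ⁆ ⊆ A
⁅⁆⊆ {c = c} {A} c∈A x∈⁅c⁆ = subst (_∈ A) (sym (x∈⁅y⁆⇒x≡y c x∈⁅c⁆)) c∈A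

restrictTo : {n : ℕ} → Subset n → List (Fin n) → Subset n
restrictTo B cs = ⋃ (map (λ c → B ∩ ⁅ c ⁆) cs)

restrictTo-⊇ : {n : ℕ} {B : Subset n} {c : Fin n} (cs : List (Fin n)) →
               c List.∈ cs → c ∈ B → c ∈ restrictTo B cs
restrictTo-⊇ {B = B} {c} (c ∷ cs) (here refl) c∈B =
  p⊆p∪q (restrictTo B cs) (x∈p∩q⁺ (c∈B , x∈⁅x⁆ c))
restrictTo-⊇ {B = B} (d ∷ cs) (there c∈cs) c∈B =
  q⊆p∪q (B ∩ ⁅ d ⁆) (restrictTo B cs) (restrictTo-⊇ cs c∈cs c∈B)

module DerivedRules {N : Network} {X : Formula N → Set} where

  infix 3 ⊢_
  ⊢_ : Formula N → Set
  ⊢_ = Derivable N X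

  chain : {A B C : ChSet N} → ⊢ A ▷ B → ⊢ B ▷ C → ⊢ A ▷ C
  chain A▷B B▷C = mp (mp transitivity A▷B) B▷C

  weaken : {A B C : ChSet N} → ⊢ A ▷ B → C ⊆ B → ⊢ A ▷ C
  weaken A▷B C⊆B = chain A▷B (reflexivity C⊆B)

  -- Union rule: A ▷ S ∪ A by augmenting A ▷ S with A, then augmenting
  -- A ▷ T with S gives A ∪ S ▷ T ∪ S; the rest is reordering unions.
  ▷-∪ : {A S T : ChSet N} → ⊢ A ▷ S → ⊢ A ▷ T → ⊢ A ▷ (S ∪ T)
  ▷-∪ {A} {S} {T} A▷S A▷T =
    chain (chain A▷S∪A (reflexivity (⊆-reflexive (∪-comm A S))))
          (weaken (mp augmentation A▷T) (⊆-reflexive (∪-comm S T)))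
    where
      A▷S∪A : ⊢ A ▷ (S ∪ A)
      A▷S∪A = chain (reflexivity (⊆-reflexive (∪-idem A))) (mp augmentation A▷S)

  ▷-piece : {A B : ChSet N} → (∀ c → c ∈ B → ⊢ A ▷ ⁅ c ⁆) →
            (c : Channel N) → ⊢ A ▷ (B ∩ ⁅ c ⁆)
  ▷-piece {A} {B} A▷c c with c ∈? B
  ... | yes c∈B = weaken (A▷c c c∈B) (p∩q⊆q B ⁅ c ⁆)
  ... | no  c∉B = reflexivity piece-empty
    where
      piece-empty : B ∩ ⁅ c ⁆ ⊆ A
      piece-empty x∈ with x∈p∩q⁻ B ⁅ c ⁆ x∈
      ... | x∈B , x∈⁅c⁆ = ⊥-elim (c∉B (subst (_∈ B) (x∈⁅y⁆⇒x≡y c x∈⁅c⁆) x∈B))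

  ▷-pointwise : {A B : ChSet N} → (∀ c → c ∈ B → ⊢ A ▷ ⁅ c ⁆) → ⊢ A ▷ B
  ▷-pointwise {A} {B} A▷c =
    weaken (▷-restrictTo (allFin _)) (λ c∈B → restrictTo-⊇ (allFin _) (∈-allFin _) c∈B)
    where
      ▷-restrictTo : (cs : List (Channel N)) → ⊢ A ▷ restrictTo B cs
      ▷-restrictTo [] = reflexivity ⊥⊆
      ▷-restrictTo (c ∷ cs) = ▷-∪ (▷-piece A▷c c) (▷-restrictTo cs)

module Separation (N : Network) (X : Formula N → Set) (A : ChSet N)
                  (star? : (c : Channel N) → Dec (P₀.Star N X A c)) where
  open P₀ N X

  mark : {E : ChSet N} {c : Channel N} → Dec (E ≡ A) → Dec (Star A c) → Bool
  mark (yes _) (no _) = true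
  mark _       _      = false

  star⇒unmarked : {E : ChSet N} {c : Channel N} → Star A c →
                  (e : Dec (E ≡ A)) (d : Dec (Star A c)) → mark e d ≡ false
  star⇒unmarked c∈A* (yes _) (no c∉A*) = ⊥-elim (c∉A* c∈A*)
  star⇒unmarked c∈A* (yes _) (yes _)   = refl
  star⇒unmarked c∈A* (no _)  _         = refl

  mark-inV : {E : ChSet N} {c : Channel N} (e : Dec (E ≡ A)) (d : Dec (Star A c)) →
             Star E c → mark e d ≡ false
  mark-inV (yes refl) d c∈E* = star⇒unmarked c∈E* (yes refl) d
  mark-inV (no _)     _ _    = refl

  mark-local : {E : ChSet N} {c d : Channel N}
               (e : Dec (E ≡ A)) (dc : Dec (Star A c)) (dd : Dec (Star A d)) →
               ¬ Star E c → ¬ Star E d → mark e dc ≡ mark e dd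
  mark-local (no _)     _          _          _     _     = refl
  mark-local (yes refl) (yes c∈A*) _          c∉A* _     = ⊥-elim (c∉A* c∈A*)
  mark-local (yes refl) (no _)     (yes d∈A*) _     d∉A* = ⊥-elim (d∉A* d∈A*)
  mark-local (yes refl) (no _)     (no _)     _     _     = refl

  unmarked⇒star : {c : Channel N} (e : Dec (A ≡ A)) (d : Dec (Star A c)) →
                  mark e d ≡ false → Star A c
  unmarked⇒star (yes _)   (no _)     ()
  unmarked⇒star _         (yes c∈A*) _ = c∈A*
  unmarked⇒star (no A≢A)  (no _)     _ = ⊥-elim (A≢A refl)

  zeroRun : Run
  zeroRun = record
    { val   = λ _ _ → false
    ; inV   = λ _ _ _ → refl
    ; local = λ _ _ _ _ _ _ _ _ → refl
    }

  separatingRun : Run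
  separatingRun = record
    { val   = λ c E → mark (E ≟ˢ A) (star? c)
    ; inV   = λ c E → mark-inV (E ≟ˢ A) (star? c)
    ; local = λ p E c d _ _ → mark-local (E ≟ˢ A) (star? c) (star? d)
    }

  -- The two runs agree on A, since A ⊆ A* by Reflexivity.
  agreeOnA : (c : Channel N) → c ∈ A → AgreeOn zeroRun separatingRun c
  agreeOnA c c∈A E = sym (star⇒unmarked (reflexivity (⁅⁆⊆ c∈A)) (E ≟ˢ A) (star? c))

  determined⇒star : {B : ChSet N} → FunctionallyDetermines A B →
                    (c : Channel N) → c ∈ B → Star A c
  determined⇒star A→B c c∈B =
    unmarked⇒star (A ≟ˢ A) (star? c) (sym (A→B zeroRun separatingRun agreeOnA c c∈B A))

theorem7 : ExcludedMiddle 0ℓ →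
    (N : Network) (X : Formula N → Set) (A B : ChSet N) →
    P₀.FunctionallyDetermines N X A B → Derivable N X (A ▷ B)
theorem7 em N X A B A→B =
  DerivedRules.▷-pointwise (Separation.determined⇒star N X A (λ _ → em) A→B)
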